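{- Let $P$ and $Q$ be finite graded posets and let $f:P\to Q$ be a surjective rank-preserving poset map. Assume that for every $q\in Q$ the fiber $f^{ -1}(\langle q\rangle)$ is strongly constructible. If $Q$ is strongly constructible, then so is $P$.
   Context: A poset is graded if all its maximal chains have the same length (its rank); ranks of elements are lengths of maximal chains below them, and a rank-preserving map preserves ranks of elements. $\langle q\rangle=\{q'\in Q: q'\le q\}$. A poset is bounded if it has a minimum and a maximum; it is (pure) shellable if its order complex (simplicial complex of chains) is pure and shellable, i.e. its facets admit an order $F_1,\dots,F_m$ such that for each $i\ge2$ the intersection of the simplex on $F_i$ with the complex generated by $F_1,\dots,F_{i-1}$ is generated by a nonempty set of maximal proper faces of $F_i$. A graded poset $P$ of rank $n$ with a minimum element is strongly constructible if either (i) $P$ is bounded and pure shellable, or (ii) $P$ is the union of two strongly constructible proper order ideals $J_1,J_2$ of rank $n$ such that $J_1\cap J_2$ is a strongly constructible poset of rank at least $n-1$. -}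

module Defs where

open import Data.Nat using (ℕ; suc; _∸_) renaming (_≤_ to _≤ℕ_; _<_ to _<ℕ_)
open import Data.Fin using (Fin; toℕ)
open import Data.List using (List; []; length; lookup)
open import Data.List.Membership.Propositional using (_∈_; _∉_)
open import Data.List.Relation.Unary.All using (All)
open import Data.List.Relation.Unary.Any using (Any)
open import Data.List.Relation.Unary.Linked using (Linked)
open import Data.List.Relation.Unary.Unique.Propositional using (Unique)
open import Data.Product using (Σ; ∃; _×_)
open import Data.Sum using (_⊎_)
open import Data.Unit using (⊤)
open import Relation.Nullary using (¬_)
open import Relation.Binary using (IsPartialOrder; Decidable)
open import Relation.Binary.PropositionalEquality using (_≡_; _≢_)

-- A finite poset, presented (up to isomorphism) on the carrier Fin size.
record FinPoset : Set₁ where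
  field
    size           : ℕ
    _≤_            : Fin size → Fin size → Set
    isPartialOrder : IsPartialOrder _≡_ _≤_
    _≤?_           : Decidable _≤_

  Elt : Set
  Elt = Fin size

  _<_ : Elt → Elt → Set
  x < y = (x ≤ y) × (x ≢ y)

open FinPoset public using (Elt)

-- Subsets of the carrier; a subset S is regarded as the induced subposet.
SubP : FinPoset → Set₁
SubP P = Elt P → Set

full : (P : FinPoset) → SubP P
full P = λ _ → ⊤

_⊆ₗ_ : {A : Set} → List A → List A → Set
G ⊆ₗ F = ∀ {v} → v ∈ G → v ∈ F

module _ (P : FinPoset) where
  open FinPoset P hiding (Elt)
  private
    E : Set
    E = Elt P

  IsChain : SubP P → List E → Set
  IsChain S c = All S c × Linked _<_ c

  -- maximal chains = facets of the order complex of S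
  IsMaxChain : SubP P → List E → Set
  IsMaxChain S c = IsChain S c ×
    (∀ x → S x → All (λ y → (x ≤ y) ⊎ (y ≤ x)) c → x ∈ c)

  -- S is graded of rank n: every maximal chain has length n (n+1 elements)
  Graded : SubP P → ℕ → Set
  Graded S n = ∀ c → IsMaxChain S c → length c ≡ suc n

  Down : SubP P → E → SubP P
  Down S x = λ y → S y × (y ≤ x)

  HasRank : SubP P → E → ℕ → Set
  HasRank S x k = Σ (List E) λ c → IsMaxChain (Down S x) c × length c ≡ suc k

  IsMin : SubP P → E → Set
  IsMin S m = S m × (∀ x → S x → m ≤ x)

  IsMax : SubP P → E → Set
  IsMax S m = S m × (∀ x → S x → x ≤ m)

  HasMin : SubP P → Set
  HasMin S = ∃ (IsMin S)

  Bounded : SubP P → Set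
  Bounded S = ∃ (IsMin S) × ∃ (IsMax S)

  Pure : SubP P → Set
  Pure S = ∀ c d → IsMaxChain S c → IsMaxChain S d → length c ≡ length d

  IsShelling : SubP P → List (List E) → Set
  IsShelling S Fs =
    Unique Fs × All (IsMaxChain S) Fs × (∀ c → IsMaxChain S c → c ∈ Fs) ×
    (∀ (i : Fin (length Fs)) → 1 ≤ℕ toℕ i →
      Σ (List E) λ T →
        (T ≢ []) × All (_∈ lookup Fs i) T ×
        -- a face G lies in ⟨F_i⟩ ∩ ⟨F_1,…,F_{i-1}⟩ iff it lies in
        -- some maximal proper face F_i ∖ {x} with x ∈ T
        (∀ (G : List E) →
          ((G ⊆ₗ lookup Fs i ×
             Σ (Fin (length Fs)) λ j → (toℕ j <ℕ toℕ i) × (G ⊆ₗ lookup Fs j))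
           → Any (λ x → (G ⊆ₗ lookup Fs i) × (x ∉ G)) T)
          × (Any (λ x → (G ⊆ₗ lookup Fs i) × (x ∉ G)) T
           → (G ⊆ₗ lookup Fs i ×
             Σ (Fin (length Fs)) λ j → (toℕ j <ℕ toℕ i) × (G ⊆ₗ lookup Fs j)))))

  PureShellable : SubP P → Set
  PureShellable S = Pure S × ∃ (IsShelling S)

  IsIdeal : SubP P → SubP P → Set
  IsIdeal S J = (∀ x → J x → S x) × (∀ x y → J x → S y → y ≤ x → J y)

  ProperIn : SubP P → SubP P → Set
  ProperIn S J = Σ E λ x → S x × ¬ J x

  data SC : SubP P → ℕ → Set₁ where
    sc-shell : ∀ {S n} → Graded S n → HasMin S → Bounded S → PureShellable S → SC S n
    sc-union : ∀ {S n} (J₁ J₂ : SubP P) (k : ℕ) →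
      Graded S n → HasMin S →
      IsIdeal S J₁ → IsIdeal S J₂ → ProperIn S J₁ → ProperIn S J₂ →
      (∀ x → S x → J₁ x ⊎ J₂ x) →
      SC J₁ n → SC J₂ n → SC (λ x → J₁ x × J₂ x) k → n ∸ 1 ≤ℕ k → SC S n

StronglyConstructible : FinPoset → Set₁
StronglyConstructible P = ∃ λ n → SC P (full P) n

IsGraded : FinPoset → Set
IsGraded P = ∃ λ n → Graded P (full P) n

OrderPreserving : (P Q : FinPoset) → (Elt P → Elt Q) → Set
OrderPreserving P Q f = ∀ x y → FinPoset._≤_ P x y → FinPoset._≤_ Q (f x) (f y)

Surj : (P Q : FinPoset) → (Elt P → Elt Q) → Set
Surj P Q f = ∀ q → ∃ λ p → f p ≡ q

RankPreserving : (P Q : FinPoset) → (Elt P → Elt Q) → Set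
RankPreserving P Q f = ∀ x k → HasRank P (full P) x k → HasRank Q (full Q) (f x) k

Fiber : (P Q : FinPoset) → (Elt P → Elt Q) → Elt Q → SubP P
Fiber P Q f q = λ p → FinPoset._≤_ Q (f p) q

-- By induction on the derivation that Q is strongly constructible we show that f⁻¹(S) is
-- strongly constructible of the same rank for every down-closed S ⊆ Q.  A decomposition
-- S = J₁ ∪ J₂ pulls back to the decomposition f⁻¹(J₁) ∪ f⁻¹(J₂), with intersection
-- f⁻¹(J₁ ∩ J₂).  If S is bounded with maximum q, then S = ⟨q⟩ and f⁻¹(S) is the fibre over q,
-- strongly constructible by hypothesis; its rank is that of ⟨q⟩, because a maximal chain
-- of the fibre can be chosen to end in an element t over q, and f preserves the rank of t.
module Submission where

open import Defs
open import Data.Empty using (⊥-elim)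
open import Data.Fin.Induction using (po-wellFounded; po-noetherian)
open import Data.Fin.Properties using (any?) renaming (_≟_ to _≟ᶠ_)
open import Data.List using (List; []; _∷_; _++_; [_]; length)
open import Data.List.Membership.Propositional using (_∈_)
open import Data.List.Membership.Propositional.Properties using (∈-++⁺ˡ; ∈-++⁺ʳ)
open import Data.List.Relation.Unary.All as All using (All; []; _∷_)
open import Data.List.Relation.Unary.All.Properties using (++⁺; ++⁻ˡ)
open import Data.List.Relation.Unary.Any using (here; there)
open import Data.List.Relation.Unary.Linked using (Linked; []; [-]; _∷_)
open import Data.Nat using (ℕ; suc)
open import Data.Nat.Properties using (suc-injective)
open import Data.Product using (∃; _×_; _,_; proj₁; proj₂; map₂; swap)
open import Data.Sum using (_⊎_; inj₁; inj₂)
open import Data.Unit using (tt)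
open import Function using (flip; _∘′_)
open import Induction.WellFounded using (Acc; acc)
open import Relation.Binary using (IsPartialOrder)
open import Relation.Binary.PropositionalEquality using (_≡_; refl; sym; trans; subst)
open import Relation.Nullary using (¬_; Dec; yes; no)
open import Relation.Nullary.Decidable using (_×-dec_; ¬?)
open import Relation.Unary using (_⊆_; _≐_; _∩_; _⊢_; Decidable)

module FinPosetProperties (P : FinPoset) where
  open FinPoset P hiding (Elt)
  open IsPartialOrder isPartialOrder public using (antisym) renaming (trans to ≤-trans)

  private variable
    S T D J J₁ J₂ : SubP P
    n : ℕ
    m p t x : Elt P
    xs c : List (Elt P)

  ≤-refl : x ≤ x
  ≤-refl = IsPartialOrder.reflexive isPartialOrder refl

  ⟨_⟩ : Elt P → SubP P
  ⟨ t ⟩ = Down P (full P) t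

  DownClosed : SubP P → Set
  DownClosed S = ∀ {x y} → y ≤ x → S x → S y

  Maximal : SubP P → Elt P → Set
  Maximal D t = D t × (∀ {x} → D x → t ≤ x → x ≡ t)

  isMaxChain-resp : S ≐ T → IsMaxChain P S c → IsMaxChain P T c
  isMaxChain-resp (S⊆T , T⊆S) ((cS , linked) , maximal) =
    (All.map S⊆T cS , linked) , λ x Tx → maximal x (T⊆S Tx)

  graded-resp : S ≐ T → Graded P S n → Graded P T n
  graded-resp S≐T graded c mc = graded c (isMaxChain-resp (swap S≐T) mc)

  isMin-resp : S ≐ T → IsMin P S m → IsMin P T m
  isMin-resp (S⊆T , T⊆S) (Sm , least) = S⊆T Sm , λ x Tx → least x (T⊆S Tx)

  isMax-resp : S ≐ T → IsMax P S m → IsMax P T m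
  isMax-resp (S⊆T , T⊆S) (Sm , greatest) = S⊆T Sm , λ x Tx → greatest x (T⊆S Tx)

  pureShellable-resp : S ≐ T → PureShellable P S → PureShellable P T
  pureShellable-resp S≐T (pure , Fs , unique , facets , complete , shelling) =
    (λ c d mc md → pure c d (isMaxChain-resp (swap S≐T) mc) (isMaxChain-resp (swap S≐T) md)) ,
    Fs , unique , All.map (isMaxChain-resp S≐T) facets ,
    (λ c mc → complete c (isMaxChain-resp (swap S≐T) mc)) , shelling

  isIdeal-resp : S ≐ T → IsIdeal P S J → IsIdeal P T J
  isIdeal-resp (S⊆T , T⊆S) (J⊆S , closed) =
    (λ x Jx → S⊆T (J⊆S x Jx)) , λ x y Jx Ty → closed x y Jx (T⊆S Ty)

  properIn-resp : S ⊆ T → ProperIn P S J → ProperIn P T J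
  properIn-resp S⊆T (x , Sx , ¬Jx) = x , S⊆T Sx , ¬Jx

  SC-resp : S ≐ T → SC P S n → SC P T n
  SC-resp S≐T (sc-shell graded (m , least) (min , max) shellable) =
    sc-shell (graded-resp S≐T graded) (m , isMin-resp S≐T least)
      (map₂ (isMin-resp S≐T) min , map₂ (isMax-resp S≐T) max)
      (pureShellable-resp S≐T shellable)
  SC-resp S≐T (sc-union J₁ J₂ k graded (m , least) ideal₁ ideal₂ proper₁ proper₂ cover
                 sc₁ sc₂ sc₁₂ rank≤) =
    sc-union J₁ J₂ k (graded-resp S≐T graded) (m , isMin-resp S≐T least)
      (isIdeal-resp S≐T ideal₁) (isIdeal-resp S≐T ideal₂)
      (properIn-resp (proj₁ S≐T) proper₁) (properIn-resp (proj₁ S≐T) proper₂)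
      (λ x Tx → cover x (proj₂ S≐T Tx)) sc₁ sc₂ sc₁₂ rank≤

  SC-graded : SC P S n → Graded P S n
  SC-graded (sc-shell graded _ _ _)                       = graded
  SC-graded (sc-union _ _ _ graded _ _ _ _ _ _ _ _ _ _) = graded

  SC-hasMin : SC P S n → HasMin P S
  SC-hasMin (sc-shell _ min _ _)                       = min
  SC-hasMin (sc-union _ _ _ _ min _ _ _ _ _ _ _ _ _) = min

  ideal-downClosed : DownClosed S → IsIdeal P S J → DownClosed J
  ideal-downClosed closedS (J⊆S , closedJ) y≤x Jx =
    closedJ _ _ Jx (closedS y≤x (J⊆S _ Jx)) y≤x

  downClosed-∩ : DownClosed J₁ → DownClosed J₂ → DownClosed (J₁ ∩ J₂)
  downClosed-∩ closed₁ closed₂ y≤x (J₁x , J₂x) = closed₁ y≤x J₁x , closed₂ y≤x J₂x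

  downClosed-max⇒≐⟨⟩ : DownClosed S → IsMax P S t → S ≐ ⟨ t ⟩
  downClosed-max⇒≐⟨⟩ closed (St , greatest) =
    (λ {x} Sx → tt , greatest x Sx) , λ (_ , x≤t) → closed x≤t St

  chain-top : Linked _<_ (x ∷ xs) → ∃ λ t → t ∈ x ∷ xs × All (_≤ t) (x ∷ xs)
  chain-top {x = x} {xs = []} _ = x , here refl , ≤-refl ∷ []
  chain-top ((x≤y , _) ∷ linked) with chain-top linked
  ... | t , t∈ , y≤t ∷ below = t , there t∈ , ≤-trans x≤y y≤t ∷ y≤t ∷ below

  linked-snoc : Linked _<_ xs → All (_< t) xs → Linked _<_ (xs ++ [ t ])
  linked-snoc {xs = []}         _              _            = [-]
  linked-snoc {xs = _ ∷ []}     _              (x<t ∷ [])   = x<t ∷ [-]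
  linked-snoc {xs = _ ∷ _ ∷ _} (x<y ∷ linked) (_ ∷ below)  = x<y ∷ linked-snoc linked below

  maxChain-restrict : J ⊆ S → All J c → IsMaxChain P S c → IsMaxChain P J c
  maxChain-restrict J⊆S cJ ((_ , linked) , maximal) = (cJ , linked) , λ x Jx → maximal x (J⊆S Jx)

  ideal-allBelow : IsIdeal P S J → J t → All S c → All (_≤ t) c → All J c
  ideal-allBelow (_ , closed) Jt cS c≤t =
    All.zipWith (λ (Sy , y≤t) → closed _ _ Jt Sy y≤t) (cS , c≤t)

  chain-inIdeal : IsIdeal P S J₁ → IsIdeal P S J₂ → (∀ x → S x → J₁ x ⊎ J₂ x) →
                  IsChain P S c → All J₁ c ⊎ All J₂ c
  chain-inIdeal {c = []} _ _ _ _ = inj₁ []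
  chain-inIdeal {c = _ ∷ _} ideal₁ ideal₂ cover (cS , linked) with chain-top linked
  ... | t , t∈ , c≤t with cover t (All.lookup cS t∈)
  ... | inj₁ J₁t = inj₁ (ideal-allBelow ideal₁ J₁t cS c≤t)
  ... | inj₂ J₂t = inj₂ (ideal-allBelow ideal₂ J₂t cS c≤t)

  graded-∪ : IsIdeal P S J₁ → IsIdeal P S J₂ → (∀ x → S x → J₁ x ⊎ J₂ x) →
             Graded P J₁ n → Graded P J₂ n → Graded P S n
  graded-∪ ideal₁ ideal₂ cover graded₁ graded₂ c mc
    with chain-inIdeal ideal₁ ideal₂ cover (proj₁ mc)
  ... | inj₁ cJ₁ = graded₁ c (maxChain-restrict (λ {x} → proj₁ ideal₁ x) cJ₁ mc)
  ... | inj₂ cJ₂ = graded₂ c (maxChain-restrict (λ {x} → proj₁ ideal₂ x) cJ₂ mc)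

  _<?_ : ∀ x y → Dec (x < y)
  x <? y = (x ≤? y) ×-dec ¬? (x ≟ᶠ y)

  ≤-<-trans : x ≤ p → p < t → x < t
  ≤-<-trans x≤p (p≤t , p≢t) =
    ≤-trans x≤p p≤t , λ { refl → p≢t (antisym p≤t x≤p) }

  maximal-above : Decidable D → D p → ∃ λ t → p ≤ t × Maximal D t
  maximal-above {D} {p} D? Dp = go Dp (po-noetherian isPartialOrder p)
    where
    go : ∀ {p} → D p → Acc (flip _<_) p → ∃ λ t → p ≤ t × Maximal D t
    go {p} Dp (acc above) with any? (λ x → D? x ×-dec (p <? x))
    ... | yes (x , Dx , p<x) with go Dx (above p<x)
    ...   | t , x≤t , maximal = t , ≤-trans (proj₁ p<x) x≤t , maximal
    go {p} Dp _ | no nothingAbove = p , ≤-refl , Dp , atMost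
      where
      atMost : ∀ {x} → D x → p ≤ x → x ≡ p
      atMost {x} Dx p≤x with p ≟ᶠ x
      ... | yes p≡x = sym p≡x
      ... | no  p≢x = ⊥-elim (nothingAbove (x , Dx , p≤x , p≢x))

  top∈maxChain : IsMaxChain P ⟨ t ⟩ c → t ∈ c
  top∈maxChain ((c≤t , _) , maximal) = maximal _ (tt , ≤-refl) (All.map (inj₂ ∘′ proj₂) c≤t)

  minimal⇒maxChain : ¬ ∃ (_< t) → IsMaxChain P ⟨ t ⟩ [ t ]
  minimal⇒maxChain {t} nothingBelow =
    ((tt , ≤-refl) ∷ [] , [-]) , λ x (_ , x≤t) _ → here (equal x≤t)
    where
    equal : x ≤ t → x ≡ t
    equal {x} x≤t with x ≟ᶠ t
    ... | yes x≡t = x≡t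
    ... | no  x≢t = ⊥-elim (nothingBelow (x , x≤t , x≢t))

  maxChain-snoc : Maximal (_< t) x → IsMaxChain P ⟨ x ⟩ c → IsMaxChain P ⟨ t ⟩ (c ++ [ t ])
  maxChain-snoc {t} {x} {c} (x<t , xMaximal) mc@((c≤x , linked) , maximal) =
    (++⁺ (All.map (λ (_ , y≤x) → tt , proj₁ (≤-<-trans y≤x x<t)) c≤x) ((tt , ≤-refl) ∷ []) ,
     linked-snoc linked (All.map (λ (_ , y≤x) → ≤-<-trans y≤x x<t) c≤x)) ,
    maximal′
    where
    maximal′ : ∀ z → ⟨ t ⟩ z → All (λ y → (z ≤ y) ⊎ (y ≤ z)) (c ++ [ t ]) → z ∈ c ++ [ t ]
    maximal′ z (_ , z≤t) comparable with z ≟ᶠ t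
    ... | yes refl = ∈-++⁺ʳ c (here refl)
    ... | no  z≢t with All.lookup (++⁻ˡ c comparable) (top∈maxChain mc)
    ...   | inj₁ z≤x = ∈-++⁺ˡ (maximal z (tt , z≤x) (++⁻ˡ c comparable))
    ...   | inj₂ x≤z = ∈-++⁺ˡ (subst (_∈ c) (sym (xMaximal (z≤t , z≢t) x≤z)) (top∈maxChain mc))

  maxChain-exists : ∀ t → ∃ (IsMaxChain P ⟨ t ⟩)
  maxChain-exists t = go (po-wellFounded isPartialOrder t)
    where
    go : ∀ {t} → Acc _<_ t → ∃ (IsMaxChain P ⟨ t ⟩)
    go {t} (acc below) with any? (_<? t)
    ... | no nothingBelow = [ t ] , minimal⇒maxChain nothingBelow
    ... | yes (_ , y<t) with maximal-above (_<? t) y<t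
    ... | x , _ , xMaximal with go (below (proj₁ xMaximal))
    ... | c , mc = c ++ [ t ] , maxChain-snoc xMaximal mc

  maxChain-below-maximal : DownClosed D → Maximal D t → IsMaxChain P ⟨ t ⟩ c → IsMaxChain P D c
  maxChain-below-maximal {D} {t} {c} closed (Dt , tMaximal) mc@((c≤t , linked) , maximal) =
    (All.map (λ (_ , y≤t) → closed y≤t Dt) c≤t , linked) , maximal′
    where
    maximal′ : ∀ x → D x → All (λ y → (x ≤ y) ⊎ (y ≤ x)) c → x ∈ c
    maximal′ x Dx comparable with All.lookup comparable (top∈maxChain mc)
    ... | inj₁ x≤t = maximal x (tt , x≤t) comparable
    ... | inj₂ t≤x = subst (_∈ c) (sym (tMaximal Dx t≤x)) (top∈maxChain mc)

module Preimage (P Q : FinPoset) (f : Elt P → Elt Q) (monotone : OrderPreserving P Q f) where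
  module P = FinPosetProperties P
  module Q = FinPosetProperties Q
  open FinPoset P using () renaming (_≤_ to _≤ᴾ_)
  open FinPoset Q using () renaming (_≤_ to _≤ᴼ_; _≤?_ to _≤ᴼ?_)

  private variable
    S J : SubP Q
    k n : ℕ
    p : Elt P
    q : Elt Q

  fiber-downClosed : P.DownClosed (Fiber P Q f q)
  fiber-downClosed y≤x fx≤q = Q.≤-trans (monotone _ _ y≤x) fx≤q

  preimage-isIdeal : IsIdeal Q S J → IsIdeal P (f ⊢ S) (f ⊢ J)
  preimage-isIdeal (J⊆S , closed) =
    (λ x → J⊆S (f x)) , λ x y Jfx Sfy y≤x → closed (f x) (f y) Jfx Sfy (monotone y x y≤x)

  preimage-properIn : Surj P Q f → ProperIn Q S J → ProperIn P (f ⊢ S) (f ⊢ J)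
  preimage-properIn surj (q , Sq , ¬Jq) with surj q
  ... | p , refl = p , Sq , ¬Jq

  preimage-hasMin : (∀ q → HasMin P (Fiber P Q f q)) → Q.DownClosed S → HasMin Q S →
                    HasMin P (f ⊢ S)
  preimage-hasMin fiberMin closed (m , Sm , least) with fiberMin m
  ... | p₀ , fp₀≤m , leastOverM = p₀ , closed fp₀≤m Sm , λ x Sfx → p₀≤ x (least (f x) Sfx)
    where
    -- The least element p of the fibre over f x lies below p₀, hence in the fibre over m,
    -- so p₀ ≤ p ≤ x.
    p₀≤ : ∀ x → m ≤ᴼ f x → p₀ ≤ᴾ x
    p₀≤ x m≤fx with fiberMin (f x)
    ... | p , _ , leastOverFx = P.≤-trans p₀≤p (leastOverFx x Q.≤-refl)
      where
      p≤p₀ : p ≤ᴾ p₀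
      p≤p₀ = leastOverFx p₀ (Q.≤-trans fp₀≤m m≤fx)

      p₀≤p : p₀ ≤ᴾ p
      p₀≤p = leastOverM p (Q.≤-trans (monotone p p₀ p≤p₀) fp₀≤m)

  fiber-rank : RankPreserving P Q f → f p ≡ q →
               Graded P (Fiber P Q f q) k → Graded Q Q.⟨ q ⟩ n → k ≡ n
  fiber-rank {p} {k = k} rankPreserving refl gradedFiber graded⟨fp⟩
    with P.maximal-above (λ x → f x ≤ᴼ? f p) Q.≤-refl
  ... | t , p≤t , tMaximal@(ft≤fp , _) with P.maxChain-exists t
  ... | c , mc with rankPreserving t k (c , mc , length-c)
    where
    length-c : length c ≡ suc k
    length-c = gradedFiber c (P.maxChain-below-maximal fiber-downClosed tMaximal mc)
  ... | d , md , length-d = suc-injective (trans (sym length-d) (graded⟨fp⟩ d md′))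
    where
    ft≡fp : f t ≡ f p
    ft≡fp = Q.antisym ft≤fp (monotone p t p≤t)

    md′ : IsMaxChain Q Q.⟨ f p ⟩ d
    md′ = subst (λ q → IsMaxChain Q Q.⟨ q ⟩ d) ft≡fp md

  module _ (surj : Surj P Q f) (rankPreserving : RankPreserving P Q f)
           (fibers : ∀ q → ∃ λ k → SC P (Fiber P Q f q) k) where

    SC-preimage : SC Q S n → Q.DownClosed S → SC P (f ⊢ S) n
    SC-preimage {S} {n} (sc-shell graded _ (_ , q , max) _) closed with fibers q
    ... | k , scFiber = subst (SC P (f ⊢ S)) k≡n (P.SC-resp Fiber≐f⁻¹S scFiber)
      where
      S≐⟨q⟩ : S ≐ Q.⟨ q ⟩
      S≐⟨q⟩ = Q.downClosed-max⇒≐⟨⟩ closed max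

      Fiber≐f⁻¹S : Fiber P Q f q ≐ f ⊢ S
      Fiber≐f⁻¹S = (λ fx≤q → proj₂ S≐⟨q⟩ (tt , fx≤q)) , λ Sfx → proj₂ (proj₁ S≐⟨q⟩ Sfx)

      k≡n : k ≡ n
      k≡n = fiber-rank rankPreserving (proj₂ (surj q)) (P.SC-graded scFiber)
              (Q.graded-resp S≐⟨q⟩ graded)
    SC-preimage {S} {n}
      (sc-union J₁ J₂ k _ min ideal₁ ideal₂ proper₁ proper₂ cover sc₁ sc₂ sc₁₂ rank≤) closed =
      sc-union (f ⊢ J₁) (f ⊢ J₂) k
        (P.graded-∪ idealᴾ₁ idealᴾ₂ coverᴾ (P.SC-graded scᴾ₁) (P.SC-graded scᴾ₂))
        (preimage-hasMin (λ q → P.SC-hasMin (proj₂ (fibers q))) closed min)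
        idealᴾ₁ idealᴾ₂ (preimage-properIn surj proper₁) (preimage-properIn surj proper₂) coverᴾ
        scᴾ₁ scᴾ₂ (SC-preimage sc₁₂ (Q.downClosed-∩ closed₁ closed₂)) rank≤
      where
      closed₁ : Q.DownClosed J₁
      closed₁ = Q.ideal-downClosed closed ideal₁

      closed₂ : Q.DownClosed J₂
      closed₂ = Q.ideal-downClosed closed ideal₂

      idealᴾ₁ : IsIdeal P (f ⊢ S) (f ⊢ J₁)
      idealᴾ₁ = preimage-isIdeal ideal₁

      idealᴾ₂ : IsIdeal P (f ⊢ S) (f ⊢ J₂)
      idealᴾ₂ = preimage-isIdeal ideal₂

      coverᴾ : ∀ x → (f ⊢ S) x → (f ⊢ J₁) x ⊎ (f ⊢ J₂) x
      coverᴾ x = cover (f x)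

      scᴾ₁ : SC P (f ⊢ J₁) n
      scᴾ₁ = SC-preimage sc₁ closed₁

      scᴾ₂ : SC P (f ⊢ J₂) n
      scᴾ₂ = SC-preimage sc₂ closed₂

theorem3p7 : (P Q : FinPoset) (f : Elt P → Elt Q) →
    IsGraded P → IsGraded Q →
    OrderPreserving P Q f → Surj P Q f → RankPreserving P Q f →
    (∀ q → ∃ λ k → SC P (Fiber P Q f q) k) →
    StronglyConstructible Q → StronglyConstructible P
theorem3p7 P Q f _ _ monotone surj rankPreserving fibers (n , scQ) =
  n , SC-preimage surj rankPreserving fibers scQ (λ _ _ → tt)
  where open Preimage P Q f monotone
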